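{- For integers $u,d,m$ with $1\le m\le\min\{u,d\}$ let $$\mathbf{P}^u_d(m)=\sum_{k=0}^{d-m}\binom{d-m}{k}\prod_{i=0}^{k-1}(m+i+1-r)(i+r)\prod_{j=k+1}^{d-m}(d-m+r-j)(u+r+j),$$ and for nonnegative integers $k$ let $\psi_k(x)=\prod_{i=1}^{k}(x+i)(i-1+2r)$. Then $$\mathbf{P}^u_d(m)\,\psi_{u-m}(m)=\mathbf{P}^d_u(m)\,\psi_{d-m}(m).$$
   Context: $r$ is an indeterminate; the identity is one of polynomials in $r$. -}

module Defs where

open import Level using (Level)
open import Data.Nat using (ℕ; zero; suc; _∸_) renaming (_+_ to _+ℕ_)
open import Data.Nat.Combinatorics using (_C_)
open import Algebra.Bundles using (CommutativeRing)

-- Polynomial identities in the indeterminate r (over ℤ) are stated as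
-- identities holding for every element r of every commutative ring
-- (ℤ[r] itself being one such ring, with r the indeterminate).
module Poly {c ℓ : Level} (R : CommutativeRing c ℓ) where
  open CommutativeRing R

  ι : ℕ → Carrier
  ι zero    = 0#
  ι (suc n) = 1# + ι n

  ∏[_,_] : ℕ → ℕ → (ℕ → Carrier) → Carrier
  ∏[ a , zero ] f    = 1#
  ∏[ a , suc n ] f   = f a * ∏[ suc a , n ] f

  Σ≤ : ℕ → (ℕ → Carrier) → Carrier
  Σ≤ zero f    = f 0
  Σ≤ (suc n) f = Σ≤ n f + f (suc n)

  P : Carrier → ℕ → ℕ → ℕ → Carrier
  P r u d m = Σ≤ (d ∸ m) λ k →
      ι ((d ∸ m) C k)
    * ∏[ 0 , k ] (λ i → (ι (m +ℕ i +ℕ 1) - r) * (ι i + r))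
    * ∏[ suc k , (d ∸ m) ∸ k ] (λ j → (ι ((d ∸ m) ∸ j) + r) * (ι (u +ℕ j) + r))

  ψ : Carrier → ℕ → Carrier → Carrier
  ψ r k x = ∏[ 1 , k ] (λ i → (x + ι i) * (ι (i ∸ 1) + (r + r)))

-- Put α = r, β = m + 1 - r, γ = r, n = d - m and p = u - m.  Then 𝐏^u_d(m) is the series
--   Σ_{k+l=n} C(n,k) (α)_k (β)_k (γ)_l (α+β+γ+p+k)_l
-- and ψ_q(m) = (α+γ)_q (β+γ)_q.  For p = 0 the series is the Pfaff–Saalschütz sum
-- (α+γ)_n (β+γ)_n, proved by telescoping along the antidiagonal k + l = n.  The series and
--   Σ_j C(p,j) C(n,j) j! (γ)_j (α+γ+j)_{n-j} (β+γ+j)_{n-j}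
-- satisfy the same recurrence in (p, n), in which γ moves to γ + 1, so they agree for all p.
-- After multiplication by (α+γ)_p (β+γ)_p the latter is visibly symmetric in p and n.
module Submission where

open import Defs
open import Level using (Level)
open import Data.Nat using (ℕ; _≤_; _∸_)
open import Algebra.Bundles using (CommutativeRing)

module Binomial where
  open import Data.Nat using (ℕ; zero; suc; _+_; _*_; _∸_; _≤_; s≤s)
  open import Data.Nat.Properties
    using (+-comm; +-suc; +-identityʳ; *-distribˡ-+; *-distribʳ-+; *-zeroʳ; m+[n∸m]≡n; ≤-<-connex)
  open import Data.Nat.Combinatorics using (_C_; nCn≡1; nCk+nC[k+1]≡[n+1]C[k+1]; k>n⇒nCk≡0)
  open import Data.Sum using (inj₁; inj₂)
  open import Relation.Binary.PropositionalEquality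
    using (_≡_; refl; sym; trans; cong; cong₂; module ≡-Reasoning)
  open ≡-Reasoning

  binom : ℕ → ℕ → ℕ
  binom zero    l       = 1
  binom (suc k) zero    = 1
  binom (suc k) (suc l) = binom k (suc l) + binom (suc k) l

  binom-sym : ∀ k l → binom k l ≡ binom l k
  binom-sym zero    zero    = refl
  binom-sym zero    (suc l) = refl
  binom-sym (suc k) zero    = refl
  binom-sym (suc k) (suc l) =
    trans (cong₂ _+_ (binom-sym k (suc l)) (binom-sym (suc k) l)) (+-comm (binom (suc l) k) (binom l (suc k)))

  binom-zeroʳ : ∀ k → binom k 0 ≡ 1
  binom-zeroʳ zero    = refl
  binom-zeroʳ (suc k) = refl

  binom-absorbʳ : ∀ k l → suc l * binom k (suc l) ≡ suc (k + l) * binom k l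
  binom-absorbˡ : ∀ k l → suc k * binom (suc k) l ≡ suc (k + l) * binom k l

  binom-absorbʳ zero    l = refl
  binom-absorbʳ (suc k) l = begin
    suc l * (binom k (suc l) + binom (suc k) l)            ≡⟨ *-distribˡ-+ (suc l) (binom k (suc l)) _ ⟩
    suc l * binom k (suc l) + suc l * binom (suc k) l      ≡⟨ cong (_+ suc l * binom (suc k) l) ih ⟩
    suc k * binom (suc k) l + suc l * binom (suc k) l      ≡⟨ *-distribʳ-+ (binom (suc k) l) (suc k) (suc l) ⟨
    (suc k + suc l) * binom (suc k) l                      ≡⟨ cong (λ a → suc a * binom (suc k) l) (+-suc k l) ⟩
    suc (suc k + l) * binom (suc k) l                      ∎
    where ih = trans (binom-absorbʳ k l) (sym (binom-absorbˡ k l))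

  binom-absorbˡ k l = begin
    suc k * binom (suc k) l   ≡⟨ cong (suc k *_) (binom-sym (suc k) l) ⟩
    suc k * binom l (suc k)   ≡⟨ binom-absorbʳ l k ⟩
    suc (l + k) * binom l k   ≡⟨ cong₂ (λ a b → suc a * b) (+-comm l k) (binom-sym l k) ⟩
    suc (k + l) * binom k l   ∎

  C≡binom : ∀ k l → (k + l) C k ≡ binom k l
  C≡binom zero    l       = refl
  C≡binom (suc k) zero    = trans (cong (_C suc k) (+-identityʳ (suc k))) (nCn≡1 (suc k))
  C≡binom (suc k) (suc l) = begin
    suc (k + suc l) C suc k                   ≡⟨ nCk+nC[k+1]≡[n+1]C[k+1] (k + suc l) k ⟨
    (k + suc l) C k + (k + suc l) C suc k     ≡⟨ cong (λ n → (k + suc l) C k + n C suc k) (+-suc k l) ⟩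
    (k + suc l) C k + (suc k + l) C suc k     ≡⟨ cong₂ _+_ (C≡binom k (suc l)) (C≡binom (suc k) l) ⟩
    binom k (suc l) + binom (suc k) l         ∎

  C≡binom∸ : ∀ {n k} → k ≤ n → n C k ≡ binom k (n ∸ k)
  C≡binom∸ {n} {k} k≤n = trans (cong (_C k) (sym (m+[n∸m]≡n k≤n))) (C≡binom k (n ∸ k))

  C-absorb : ∀ n k → suc k * (suc n C suc k) ≡ suc n * (n C k)
  C-absorb n k with ≤-<-connex k n
  ... | inj₁ k≤n = begin
    suc k * (suc n C suc k)              ≡⟨ cong (suc k *_) (C≡binom∸ (s≤s k≤n)) ⟩
    suc k * binom (suc k) (n ∸ k)        ≡⟨ binom-absorbˡ k (n ∸ k) ⟩
    suc (k + (n ∸ k)) * binom k (n ∸ k)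
      ≡⟨ cong₂ (λ a b → suc a * b) (m+[n∸m]≡n k≤n) (sym (C≡binom∸ k≤n)) ⟩
    suc n * (n C k)                      ∎
  ... | inj₂ n<k = begin
    suc k * (suc n C suc k)  ≡⟨ cong (suc k *_) (k>n⇒nCk≡0 (s≤s n<k)) ⟩
    suc k * 0                ≡⟨ *-zeroʳ (suc k) ⟩
    0                        ≡⟨ *-zeroʳ (suc n) ⟨
    suc n * 0                ≡⟨ cong (suc n *_) (k>n⇒nCk≡0 n<k) ⟨
    suc n * (n C k)          ∎

module RingSolver {c ℓ : Level} (R : CommutativeRing c ℓ) where
  open CommutativeRing R
  open import Algebra.Properties.Semiring.Mult semiring using (_×_; ×-congˡ)
  import Data.Nat as ℕ
  open import Data.Maybe using (Maybe; map)
  open import Relation.Nullary.Decidable using (dec⇒maybe)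

  private
    ×1-≟ : ∀ m n → Maybe (m × 1# ≈ n × 1#)
    ×1-≟ m n = map ×-congˡ (dec⇒maybe (m ℕ.≟ n))

  open import Algebra.Solver.Ring.NaturalCoefficients commutativeSemiring ×1-≟ public

module Pochhammer {c ℓ : Level} (R : CommutativeRing c ℓ) where
  open import Data.Nat using (zero; suc; _<_; z≤n; s≤s) renaming (_+_ to _+ℕ_; _*_ to _*ℕ_)
  import Data.Nat.Properties as ℕ
  open import Data.Nat.Combinatorics using (_C_; k>n⇒nCk≡0; nCk+nC[k+1]≡[n+1]C[k+1])
  open import Relation.Binary.PropositionalEquality as ≡ using (_≡_)
  open import Function using (_∘_)
  open CommutativeRing R
  open import Algebra.Properties.Semiring.Mult semiring using (_×_; ×-homo-+; ×1-homo-*)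
  open import Algebra.Properties.Group +-group using (∙-cancelʳ)
  open import Relation.Binary.Reasoning.Setoid setoid
  open Poly R
  open RingSolver R

  +-cancelʳ-≈ : ∀ {x y z z′} → x + z ≈ y + z′ → z ≈ z′ → x ≈ y
  +-cancelʳ-≈ {x} {y} {z} eq z≈z′ = ∙-cancelʳ z x y (trans eq (+-congˡ (sym z≈z′)))

  ι≡×1 : ∀ n → ι n ≡ n × 1#
  ι≡×1 zero    = ≡.refl
  ι≡×1 (suc n) = ≡.cong (1# +_) (ι≡×1 n)

  ι-+ : ∀ a b → ι (a +ℕ b) ≈ ι a + ι b
  ι-+ a b rewrite ι≡×1 (a +ℕ b) | ι≡×1 a | ι≡×1 b = ×-homo-+ 1# a b

  ι-* : ∀ a b → ι (a *ℕ b) ≈ ι a * ι b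
  ι-* a b rewrite ι≡×1 (a *ℕ b) | ι≡×1 a | ι≡×1 b = ×1-homo-* a b

  ι-C> : ∀ {n k} → n < k → ι (n C k) ≈ 0#
  ι-C> n<k = reflexive (≡.cong ι (k>n⇒nCk≡0 n<k))

  ∏-cong : ∀ a n {f g} → (∀ i → f i ≈ g i) → ∏[ a , n ] f ≈ ∏[ a , n ] g
  ∏-cong a zero    f≈g = refl
  ∏-cong a (suc n) f≈g = *-cong (f≈g a) (∏-cong (suc a) n f≈g)

  ∏-shift : ∀ a n f → ∏[ a , n ] f ≡ ∏[ 0 , n ] (λ i → f (a +ℕ i))
  ∏-shift zero    n f = ≡.refl
  ∏-shift (suc a) n f = ≡.trans (∏-suc a n f) (∏-shift a n (f ∘ suc))
    where
    ∏-suc : ∀ a n f → ∏[ suc a , n ] f ≡ ∏[ a , n ] (f ∘ suc)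
    ∏-suc a zero    f = ≡.refl
    ∏-suc a (suc n) f = ≡.cong (f (suc a) *_) (∏-suc (suc a) n f)

  ∏-split : ∀ a m n f → ∏[ a , m +ℕ n ] f ≈ ∏[ a , m ] f * ∏[ a +ℕ m , n ] f
  ∏-split a zero    n f =
    trans (reflexive (≡.cong (λ b → ∏[ b , n ] f) (≡.sym (ℕ.+-identityʳ a)))) (sym (*-identityˡ _))
  ∏-split a (suc m) n f = begin
    f a * ∏[ suc a , m +ℕ n ] f                          ≈⟨ *-congˡ (∏-split (suc a) m n f) ⟩
    f a * (∏[ suc a , m ] f * ∏[ suc a +ℕ m , n ] f)     ≈⟨ *-assoc _ _ _ ⟨
    f a * ∏[ suc a , m ] f * ∏[ suc a +ℕ m , n ] f
      ≡⟨ ≡.cong (λ b → f a * ∏[ suc a , m ] f * ∏[ b , n ] f) (ℕ.+-suc a m) ⟨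
    f a * ∏[ suc a , m ] f * ∏[ a +ℕ suc m , n ] f       ∎

  ∏-snoc : ∀ a n f → ∏[ a , suc n ] f ≈ ∏[ a , n ] f * f (a +ℕ n)
  ∏-snoc a n f = begin
    ∏[ a , suc n ] f                       ≡⟨ ≡.cong (λ k → ∏[ a , k ] f) (ℕ.+-comm 1 n) ⟩
    ∏[ a , n +ℕ 1 ] f                      ≈⟨ ∏-split a n 1 f ⟩
    ∏[ a , n ] f * (f (a +ℕ n) * 1#)       ≈⟨ *-congˡ (*-identityʳ _) ⟩
    ∏[ a , n ] f * f (a +ℕ n)              ∎

  ∏-distrib : ∀ a n f g → ∏[ a , n ] (λ i → f i * g i) ≈ ∏[ a , n ] f * ∏[ a , n ] g
  ∏-distrib a zero    f g = sym (*-identityˡ 1#)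
  ∏-distrib a (suc n) f g = trans (*-congˡ (∏-distrib (suc a) n f g))
    (solve 4 (λ x y z w → (x :* y) :* (z :* w) := (x :* z) :* (y :* w)) refl (f a) (g a) _ _)

  ∏-reverse : ∀ k l f → ∏[ suc k , l ] (λ j → f ((k +ℕ l) ∸ j)) ≈ ∏[ 0 , l ] f
  ∏-reverse k zero    f = refl
  ∏-reverse k (suc l) f = begin
    f ((k +ℕ suc l) ∸ suc k) * ∏[ suc (suc k) , l ] (λ j → f ((k +ℕ suc l) ∸ j))
      ≈⟨ *-cong (reflexive (≡.cong f top))
                (∏-cong (suc (suc k)) l (λ j → reflexive (≡.cong (λ q → f (q ∸ j)) (ℕ.+-suc k l)))) ⟩
    f l * ∏[ suc (suc k) , l ] (λ j → f ((suc k +ℕ l) ∸ j))    ≈⟨ *-congˡ (∏-reverse (suc k) l f) ⟩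
    f l * ∏[ 0 , l ] f                                          ≈⟨ *-comm _ _ ⟩
    ∏[ 0 , l ] f * f l                                          ≈⟨ ∏-snoc 0 l f ⟨
    ∏[ 0 , suc l ] f                                            ∎
    where top = ≡.trans (≡.cong (_∸ suc k) (ℕ.+-suc k l)) (ℕ.m+n∸m≡n (suc k) l)

  rising : Carrier → ℕ → Carrier
  rising x n = ∏[ 0 , n ] (λ i → x + ι i)

  rising-cong : ∀ {x y} n → x ≈ y → rising x n ≈ rising y n
  rising-cong n x≈y = ∏-cong 0 n (λ i → +-congʳ x≈y)

  rising-snoc : ∀ x n → rising x (suc n) ≈ rising x n * (x + ι n)
  rising-snoc x n = ∏-snoc 0 n (λ i → x + ι i)

  rising-+ : ∀ x a b → rising x (a +ℕ b) ≈ rising x a * rising (x + ι a) b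
  rising-+ x a b = begin
    rising x (a +ℕ b)                               ≈⟨ ∏-split 0 a b (λ i → x + ι i) ⟩
    rising x a * ∏[ a , b ] (λ i → x + ι i)         ≡⟨ ≡.cong (rising x a *_) (∏-shift a b (λ i → x + ι i)) ⟩
    rising x a * ∏[ 0 , b ] (λ i → x + ι (a +ℕ i))
      ≈⟨ *-congˡ (∏-cong 0 b (λ i → trans (+-congˡ (ι-+ a i)) (sym (+-assoc x (ι a) (ι i))))) ⟩
    rising x a * rising (x + ι a) b                 ∎

  rising-∸ : ∀ x {j p} → j ≤ p → rising x p ≈ rising x j * rising (x + ι j) (p ∸ j)
  rising-∸ x {j} {p} j≤p =
    trans (reflexive (≡.cong (rising x) (≡.sym (ℕ.m+[n∸m]≡n j≤p)))) (rising-+ x j (p ∸ j))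

  rising-suc : ∀ x n → rising x (suc n) ≈ x * rising (x + 1#) n
  rising-suc x n = begin
    rising x (1 +ℕ n)                 ≈⟨ rising-+ x 1 n ⟩
    (x + 0#) * 1# * rising (x + ι 1) n
      ≈⟨ *-cong (trans (*-identityʳ _) (+-identityʳ x)) (rising-cong n (+-congˡ (+-identityʳ 1#))) ⟩
    x * rising (x + 1#) n             ∎

  Σ≤-cong : ∀ n {f g} → (∀ k → k ≤ n → f k ≈ g k) → Σ≤ n f ≈ Σ≤ n g
  Σ≤-cong zero    f≈g = f≈g 0 z≤n
  Σ≤-cong (suc n) f≈g =
    +-cong (Σ≤-cong n (λ k k≤n → f≈g k (ℕ.m≤n⇒m≤1+n k≤n))) (f≈g (suc n) ℕ.≤-refl)

  Σ≤-cong′ : ∀ n {f g} → (∀ k → f k ≈ g k) → Σ≤ n f ≈ Σ≤ n g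
  Σ≤-cong′ n f≈g = Σ≤-cong n (λ k _ → f≈g k)

  Σ≤-+ : ∀ n f g → Σ≤ n (λ k → f k + g k) ≈ Σ≤ n f + Σ≤ n g
  Σ≤-+ zero    f g = refl
  Σ≤-+ (suc n) f g = trans (+-congʳ (Σ≤-+ n f g))
    (solve 4 (λ a b x y → (a :+ b) :+ (x :+ y) := (a :+ x) :+ (b :+ y)) refl _ _ _ _)

  Σ≤-*ˡ : ∀ n x f → Σ≤ n (λ k → x * f k) ≈ x * Σ≤ n f
  Σ≤-*ˡ zero    x f = refl
  Σ≤-*ˡ (suc n) x f = trans (+-congʳ (Σ≤-*ˡ n x f)) (sym (distribˡ x _ _))

  Σ≤-*ʳ : ∀ n x f → Σ≤ n (λ k → f k * x) ≈ Σ≤ n f * x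
  Σ≤-*ʳ zero    x f = refl
  Σ≤-*ʳ (suc n) x f = trans (+-congʳ (Σ≤-*ʳ n x f)) (sym (distribʳ x _ _))

  Σ≤-uncons : ∀ n f → Σ≤ (suc n) f ≈ f 0 + Σ≤ n (f ∘ suc)
  Σ≤-uncons zero    f = refl
  Σ≤-uncons (suc n) f = trans (+-congʳ (Σ≤-uncons n f)) (+-assoc _ _ _)

  Σ≤-zero : ∀ n {f} → (∀ k → f k ≈ 0#) → Σ≤ n f ≈ 0#
  Σ≤-zero zero    f≈0 = f≈0 0
  Σ≤-zero (suc n) f≈0 = trans (+-cong (Σ≤-zero n f≈0) (f≈0 (suc n))) (+-identityʳ 0#)

  Σ≤-extend : ∀ n e f → (∀ k → n < k → f k ≈ 0#) → Σ≤ (n +ℕ e) f ≈ Σ≤ n f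
  Σ≤-extend n zero    f f≈0 = reflexive (≡.cong (λ q → Σ≤ q f) (ℕ.+-identityʳ n))
  Σ≤-extend n (suc e) f f≈0 = begin
    Σ≤ (n +ℕ suc e) f                 ≡⟨ ≡.cong (λ q → Σ≤ q f) (ℕ.+-suc n e) ⟩
    Σ≤ (n +ℕ e) f + f (suc (n +ℕ e))  ≈⟨ +-cong (Σ≤-extend n e f f≈0) (f≈0 _ (s≤s (ℕ.m≤m+n n e))) ⟩
    Σ≤ n f + 0#                       ≈⟨ +-identityʳ _ ⟩
    Σ≤ n f                            ∎

  Σ≤-pascal : ∀ p (s : ℕ → Carrier) → Σ≤ (suc p) (λ j → ι (suc p C j) * s j)
                    ≈ Σ≤ p (λ j → ι (p C j) * s j) + Σ≤ p (λ j → ι (p C j) * s (suc j))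
  Σ≤-pascal p s = begin
    Σ≤ (suc p) (λ j → ι (suc p C j) * s j)
      ≈⟨ Σ≤-uncons p (λ j → ι (suc p C j) * s j) ⟩
    ι 1 * s 0 + Σ≤ p (λ j → ι (suc p C suc j) * s (suc j))
      ≈⟨ +-congˡ (Σ≤-cong′ p (λ j → trans (*-congʳ (pascal j)) (distribʳ _ _ _))) ⟩
    ι 1 * s 0 + Σ≤ p (λ j → ι (p C j) * s (suc j) + ι (p C suc j) * s (suc j))
      ≈⟨ +-congˡ (Σ≤-+ p (λ j → ι (p C j) * s (suc j)) (λ j → ι (p C suc j) * s (suc j))) ⟩
    ι 1 * s 0 + (Σ≤ p (λ j → ι (p C j) * s (suc j)) + Σ≤ p (λ j → ι (p C suc j) * s (suc j)))
      ≈⟨ solve 3 (λ a b x → a :+ (b :+ x) := (a :+ x) :+ b) refl _ _ _ ⟩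
    ι (p C 0) * s 0 + Σ≤ p (λ j → ι (p C suc j) * s (suc j)) + Σ≤ p (λ j → ι (p C j) * s (suc j))
      ≈⟨ +-congʳ (Σ≤-uncons p (λ j → ι (p C j) * s j)) ⟨
    Σ≤ p (λ j → ι (p C j) * s j) + ι (p C suc p) * s (suc p) + Σ≤ p (λ j → ι (p C j) * s (suc j))
      ≈⟨ +-congʳ (trans (+-congˡ (trans (*-congʳ (ι-C> (ℕ.n<1+n p))) (zeroˡ _))) (+-identityʳ _)) ⟩
    Σ≤ p (λ j → ι (p C j) * s j) + Σ≤ p (λ j → ι (p C j) * s (suc j))  ∎
    where
    pascal : ∀ j → ι (suc p C suc j) ≈ ι (p C j) + ι (p C suc j)
    pascal j = trans (reflexive (≡.cong ι (≡.sym (nCk+nC[k+1]≡[n+1]C[k+1] p j)))) (ι-+ (p C j) (p C suc j))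

  conv : ℕ → (ℕ → ℕ → Carrier) → Carrier
  conv zero    F = F 0 0
  conv (suc n) F = conv n (λ k l → F k (suc l)) + F (suc n) 0

  conv-cong : ∀ n {F G} → (∀ k l → k +ℕ l ≡ n → F k l ≈ G k l) → conv n F ≈ conv n G
  conv-cong zero    F≈G = F≈G 0 0 ≡.refl
  conv-cong (suc n) F≈G =
    +-cong (conv-cong n (λ k l k+l≡n → F≈G k (suc l) (≡.trans (ℕ.+-suc k l) (≡.cong suc k+l≡n))))
           (F≈G (suc n) 0 (≡.cong suc (ℕ.+-identityʳ n)))

  conv-+ : ∀ n F G → conv n (λ k l → F k l + G k l) ≈ conv n F + conv n G
  conv-+ zero    F G = refl
  conv-+ (suc n) F G = trans (+-congʳ (conv-+ n _ _))
    (solve 4 (λ a b x y → (a :+ b) :+ (x :+ y) := (a :+ x) :+ (b :+ y)) refl _ _ _ _)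

  conv-*ˡ : ∀ n x F → conv n (λ k l → x * F k l) ≈ x * conv n F
  conv-*ˡ zero    x F = refl
  conv-*ˡ (suc n) x F = trans (+-congʳ (conv-*ˡ n x _)) (sym (distribˡ x _ _))

  Σ≤≈conv : ∀ n F → Σ≤ n (λ k → F k (n ∸ k)) ≈ conv n F
  Σ≤≈conv zero    F = refl
  Σ≤≈conv (suc n) F = +-cong
    (trans (Σ≤-cong n (λ k k≤n → reflexive (≡.cong (F k) (ℕ.+-∸-assoc 1 k≤n))))
           (Σ≤≈conv n (λ k l → F k (suc l))))
    (reflexive (≡.cong (F (suc n)) (ℕ.n∸n≡0 n)))

  antidiagonal-pred : (ℕ → ℕ → Carrier) → ℕ → ℕ → Carrier
  antidiagonal-pred h zero    l = 0#
  antidiagonal-pred h (suc k) l = h k (suc l)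

  conv-telescope : ∀ n h → conv n (antidiagonal-pred h) + h n 0 ≈ conv n h
  conv-telescope zero    h = +-identityˡ _
  conv-telescope (suc n) h = begin
    conv n (λ k l → antidiagonal-pred h k (suc l)) + h n 1 + h (suc n) 0
      ≈⟨ +-congʳ (+-congʳ (conv-cong n λ { zero l _ → refl ; (suc k) l _ → refl })) ⟩
    conv n (antidiagonal-pred (λ k l → h k (suc l))) + h n 1 + h (suc n) 0
      ≈⟨ +-congʳ (conv-telescope n (λ k l → h k (suc l))) ⟩
    conv (suc n) h ∎

module Hypergeometric {c ℓ : Level} (R : CommutativeRing c ℓ) (α β : CommutativeRing.Carrier R) where
  open import Data.Nat using (zero; suc; _<_; _!; s≤s; z≤n) renaming (_+_ to _+ℕ_; _*_ to _*ℕ_)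
  import Data.Nat.Properties as ℕ
  open import Data.Nat.Combinatorics using (_C_)
  open import Data.Sum using (inj₁; inj₂)
  open import Relation.Binary.PropositionalEquality as ≡ using (_≡_)
  open CommutativeRing R
  open import Relation.Binary.Reasoning.Setoid setoid
  open Poly R
  open RingSolver R
  open Pochhammer R
  open Binomial
  open import Algebra.Properties.CommutativeSemigroup *-commutativeSemigroup using (x∙yz≈y∙xz)

  term : Carrier → Carrier → ℕ → ℕ → Carrier
  term γ D k l = ι (binom k l) * (rising α k * rising β k) * (rising γ l * rising (D + ι k) l)

  series : Carrier → Carrier → ℕ → Carrier
  series γ D n = conv n (term γ D)

  series-cong : ∀ n {γ γ′ D D′} → γ ≈ γ′ → D ≈ D′ → series γ D n ≈ series γ′ D′ n
  series-cong n γ≈γ′ D≈D′ =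
    conv-cong n (λ k l _ → *-congˡ (*-cong (rising-cong l γ≈γ′) (rising-cong l (+-congʳ D≈D′))))

  ι-binom-absorb : ∀ k l → ι (suc k) * ι (binom (suc k) l) ≈ ι (suc l) * ι (binom k (suc l))
  ι-binom-absorb k l = begin
    ι (suc k) * ι (binom (suc k) l)     ≈⟨ ι-* (suc k) (binom (suc k) l) ⟨
    ι (suc k *ℕ binom (suc k) l)        ≡⟨ ≡.cong ι (≡.trans (binom-absorbˡ k l) (≡.sym (binom-absorbʳ k l))) ⟩
    ι (suc l *ℕ binom k (suc l))        ≈⟨ ι-* (suc l) (binom k (suc l)) ⟩
    ι (suc l) * ι (binom k (suc l))     ∎

  module Saalschütz (γ : Carrier) where
    private
      δ : Carrier
      δ = α + β + γ

      F : ℕ → ℕ → Carrier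
      F = term γ δ

      h : ℕ → ℕ → Carrier
      h k l = (α + ι k) * (β + ι k) * F k l

      factor : ℕ → Carrier
      factor n = (α + γ + ι n) * (β + γ + ι n)

      step-zero : ∀ l → F 0 (suc l) + h 0 l ≈ factor l * F 0 l + 0#
      step-zero l = trans (+-congʳ (*-congˡ (*-cong (rising-snoc γ l) (rising-snoc (δ + ι 0) l))))
        (solve 6 (λ a b g G E L →
            (con 1 :+ con 0) :* (con 1 :* con 1) :* ((G :* (g :+ L)) :* (E :* (a :+ b :+ g :+ con 0 :+ L)))
             :+ (a :+ con 0) :* (b :+ con 0) :* ((con 1 :+ con 0) :* (con 1 :* con 1) :* (G :* E))
          := (a :+ g :+ L) :* (b :+ g :+ L) :* ((con 1 :+ con 0) :* (con 1 :* con 1) :* (G :* E)) :+ con 0)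
          refl α β γ (rising γ l) (rising (δ + ι 0) l) (ι l))

      -- The two sides differ by (γ + l) (α)_{j+1} (β)_{j+1} (γ)_l (δ+j+1)_l times
      -- (l+1) binom j (l+1) - (j+1) binom (j+1) l, which vanishes.
      step-suc : ∀ j l → F (suc j) (suc l) + h (suc j) l ≈ factor (suc j +ℕ l) * F (suc j) l + h j (suc l)
      step-suc j l = trans lhs (trans (+-cancelʳ-≈
          (solve 11 (λ a b g A B G E J L B01 B10 →
             (B01 :+ B10) :* ((A :* (a :+ J)) :* (B :* (b :+ J)))
               :* ((G :* (g :+ L)) :* (E :* (a :+ b :+ g :+ (con 1 :+ J) :+ L)))
              :+ (a :+ (con 1 :+ J)) :* (b :+ (con 1 :+ J)) :* (B10 :* ((A :* (a :+ J)) :* (B :* (b :+ J))) :* (G :* E))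
              :+ (A :* B :* (a :+ J) :* (b :+ J) :* G :* E) :* (g :+ L) :* ((con 1 :+ J) :* B10)
            := (a :+ g :+ (con 1 :+ (J :+ L))) :* (b :+ g :+ (con 1 :+ (J :+ L)))
                 :* (B10 :* ((A :* (a :+ J)) :* (B :* (b :+ J))) :* (G :* E))
              :+ (a :+ J) :* (b :+ J) :* (B01 :* (A :* B) :* ((G :* (g :+ L)) :* ((a :+ b :+ g :+ J) :* E)))
              :+ (A :* B :* (a :+ J) :* (b :+ J) :* G :* E) :* (g :+ L) :* ((con 1 :+ L) :* B01))
            refl α β γ (rising α j) (rising β j) (rising γ l) (rising (δ + ι (suc j)) l) (ι j) (ι l)
                 (ι (binom j (suc l))) (ι (binom (suc j) l)))
          (*-congˡ (ι-binom-absorb j l))) (sym rhs))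
        where
        A′ = *-cong (rising-snoc α j) (rising-snoc β j)
        lhs = +-cong (*-cong (*-cong (ι-+ (binom j (suc l)) (binom (suc j) l)) A′)
                             (*-cong (rising-snoc γ l) (rising-snoc _ l)))
                     (*-congˡ (*-congʳ (*-congˡ A′)))
        E′ : rising (δ + ι j) (suc l) ≈ (δ + ι j) * rising (δ + ι (suc j)) l
        E′ = trans (rising-suc (δ + ι j) l)
                   (*-congˡ (rising-cong l (trans (+-assoc δ (ι j) 1#) (+-congˡ (+-comm (ι j) 1#)))))
        j+l = +-congˡ (ι-+ j l)
        rhs = +-cong (*-cong (*-cong (+-congˡ j+l) (+-congˡ j+l)) (*-congʳ (*-congˡ A′)))
                     (*-congˡ (*-congˡ (*-cong (rising-snoc γ l) E′)))

      step : ∀ n k l → k +ℕ l ≡ n → F k (suc l) + h k l ≈ factor n * F k l + antidiagonal-pred h k l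
      step n zero    l ≡.refl = step-zero l
      step n (suc j) l ≡.refl = step-suc j l

      corner : ∀ n → F (suc n) 0 ≈ h n 0
      corner n = begin
        ι 1 * (rising α (suc n) * rising β (suc n)) * (1# * 1#)
          ≈⟨ *-congʳ (*-congˡ (*-cong (rising-snoc α n) (rising-snoc β n))) ⟩
        ι 1 * ((rising α n * (α + ι n)) * (rising β n * (β + ι n))) * (1# * 1#)
          ≈⟨ solve 5 (λ a b A B i → i :* ((A :* a) :* (B :* b)) :* (con 1 :* con 1)
                                  := a :* b :* (i :* (A :* B) :* (con 1 :* con 1))) refl _ _ _ _ _ ⟩
        (α + ι n) * (β + ι n) * (ι 1 * (rising α n * rising β n) * (1# * 1#))
          ≈⟨ *-congˡ (*-congʳ (*-congʳ (reflexive (≡.cong ι (binom-zeroʳ n))))) ⟨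
        h n 0 ∎

    series-suc : ∀ n → series γ δ (suc n) ≈ factor n * series γ δ n
    series-suc n = +-cancelʳ-≈ (begin
      conv n (λ k l → F k (suc l)) + F (suc n) 0 + conv n h
        ≈⟨ solve 3 (λ x y z → x :+ y :+ z := x :+ z :+ y) refl _ _ _ ⟩
      conv n (λ k l → F k (suc l)) + conv n h + F (suc n) 0
        ≈⟨ +-cong (sym (conv-+ n _ _)) (corner n) ⟩
      conv n (λ k l → F k (suc l) + h k l) + h n 0
        ≈⟨ +-congʳ (conv-cong n (step n)) ⟩
      conv n (λ k l → factor n * F k l + antidiagonal-pred h k l) + h n 0
        ≈⟨ +-congʳ (trans (conv-+ n _ _) (+-congʳ (conv-*ˡ n (factor n) F))) ⟩
      factor n * conv n F + conv n (antidiagonal-pred h) + h n 0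
        ≈⟨ +-assoc _ _ _ ⟩
      factor n * conv n F + (conv n (antidiagonal-pred h) + h n 0)
        ≈⟨ +-congˡ (conv-telescope n h) ⟩
      factor n * conv n F + conv n h ∎) refl

  saalschütz : ∀ γ n → series γ (α + β + γ) n ≈ rising (α + γ) n * rising (β + γ) n
  saalschütz γ zero    = solve 0 ((con 1 :+ con 0) :* (con 1 :* con 1) :* (con 1 :* con 1) := con 1 :* con 1) refl
  saalschütz γ (suc n) = begin
    series γ (α + β + γ) (suc n)                                   ≈⟨ Saalschütz.series-suc γ n ⟩
    x * y * series γ (α + β + γ) n                                 ≈⟨ *-congˡ (saalschütz γ n) ⟩
    x * y * (rising (α + γ) n * rising (β + γ) n)
      ≈⟨ solve 4 (λ x y X Y → x :* y :* (X :* Y) := X :* x :* (Y :* y)) refl x y _ _ ⟩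
    rising (α + γ) n * x * (rising (β + γ) n * y)
      ≈⟨ *-cong (rising-snoc (α + γ) n) (rising-snoc (β + γ) n) ⟨
    rising (α + γ) (suc n) * rising (β + γ) (suc n)                ∎
    where
    x = α + γ + ι n
    y = β + γ + ι n

  series-contiguity : ∀ γ D n →
    series γ (D + 1#) (suc n) ≈ series γ D (suc n) + ι (suc n) * γ * series (γ + 1#) (D + 1#) n
  series-contiguity γ D n = begin
    conv n (λ k l → term γ (D + 1#) k (suc l)) + term γ D (suc n) 0
      ≈⟨ +-congʳ (conv-cong n termwise) ⟩
    conv n (λ k l → term γ D k (suc l) + ι (suc n) * γ * term (γ + 1#) (D + 1#) k l) + term γ D (suc n) 0
      ≈⟨ +-congʳ (trans (conv-+ n _ _) (+-congˡ (conv-*ˡ n (ι (suc n) * γ) (term (γ + 1#) (D + 1#))))) ⟩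
    conv n (λ k l → term γ D k (suc l)) + ι (suc n) * γ * series (γ + 1#) (D + 1#) n + term γ D (suc n) 0
      ≈⟨ solve 3 (λ a b c → a :+ b :+ c := a :+ c :+ b) refl _ _ _ ⟩
    series γ D (suc n) + ι (suc n) * γ * series (γ + 1#) (D + 1#) n ∎
    where
    -- (D+1+k)_{l+1} - (D+k)_{l+1} = (l+1) (D+k+1)_l, and (l+1) binom k (l+1) = (n+1) binom k l.
    termwise : ∀ k l → k +ℕ l ≡ n →
      term γ (D + 1#) k (suc l) ≈ term γ D k (suc l) + ι (suc n) * γ * term (γ + 1#) (D + 1#) k l
    termwise k l k+l≡n = trans lhs (trans (+-cancelʳ-≈
        (solve 9 (λ g B1 B0 Ab G Y x L N →
            B1 :* Ab :* ((g :* G) :* (Y :* (x :+ con 1 :+ L))) :+ Ab :* g :* G :* Y :* (N :* B0)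
          := B1 :* Ab :* ((g :* G) :* (x :* Y)) :+ N :* g :* (B0 :* Ab :* (G :* Y))
               :+ Ab :* g :* G :* Y :* ((con 1 :+ L) :* B1))
          refl γ (ι (binom k (suc l))) (ι (binom k l)) (rising α k * rising β k) (rising (γ + 1#) l)
               (rising (D + 1# + ι k) l) (D + ι k) (ι l) (ι (suc n)))
        (*-congˡ absorb)) (sym rhs))
      where
      shift : D + 1# + ι k ≈ D + ι k + 1#
      shift = solve 3 (λ d o k → d :+ o :+ k := d :+ k :+ o) refl D 1# (ι k)
      lhs = *-congˡ (*-cong (rising-suc γ l) (trans (rising-snoc (D + 1# + ι k) l) (*-congˡ (+-congʳ shift))))
      rhs = +-congʳ (*-congˡ (*-cong (rising-suc γ l)
                                     (trans (rising-suc (D + ι k) l) (*-congˡ (rising-cong l (sym shift))))))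
      absorb : ι (suc n) * ι (binom k l) ≈ (1# + ι l) * ι (binom k (suc l))
      absorb = begin
        ι (suc n) * ι (binom k l)            ≈⟨ ι-* (suc n) (binom k l) ⟨
        ι (suc n *ℕ binom k l)               ≡⟨ ≡.cong (λ q → ι (suc q *ℕ binom k l)) (≡.sym k+l≡n) ⟩
        ι (suc (k +ℕ l) *ℕ binom k l)        ≡⟨ ≡.cong ι (≡.sym (binom-absorbʳ k l)) ⟩
        ι (suc l *ℕ binom k (suc l))         ≈⟨ ι-* (suc l) (binom k (suc l)) ⟩
        (1# + ι l) * ι (binom k (suc l))     ∎

  weight : Carrier → ℕ → Carrier
  weight γ q = rising (α + γ) q * rising (β + γ) q

  weight-cong : ∀ {γ γ′} q → γ ≈ γ′ → weight γ q ≈ weight γ′ q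
  weight-cong q γ≈γ′ = *-cong (rising-cong q (+-congˡ γ≈γ′)) (rising-cong q (+-congˡ γ≈γ′))

  weight-∸ : ∀ γ {j p} → j ≤ p → weight γ p ≈ weight γ j * weight (γ + ι j) (p ∸ j)
  weight-∸ γ {j} {p} j≤p = begin
    rising (α + γ) p * rising (β + γ) p
      ≈⟨ *-cong (rising-∸ (α + γ) j≤p) (rising-∸ (β + γ) j≤p) ⟩
    rising (α + γ) j * rising (α + γ + ι j) (p ∸ j) * (rising (β + γ) j * rising (β + γ + ι j) (p ∸ j))
      ≈⟨ solve 4 (λ a A b B → a :* A :* (b :* B) := a :* b :* (A :* B)) refl _ _ _ _ ⟩
    weight γ j * (rising (α + γ + ι j) (p ∸ j) * rising (β + γ + ι j) (p ∸ j))
      ≈⟨ *-congˡ (*-cong (rising-cong (p ∸ j) (+-assoc α γ (ι j))) (rising-cong (p ∸ j) (+-assoc β γ (ι j)))) ⟩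
    weight γ j * weight (γ + ι j) (p ∸ j) ∎

  coefficient : ℕ → ℕ → Carrier → Carrier
  coefficient j n γ = ι (n C j) * (ι (j !) * rising γ j * weight (γ + ι j) (n ∸ j))

  coefficient-C> : ∀ {j n} γ → n < j → coefficient j n γ ≈ 0#
  coefficient-C> γ n<j = trans (*-congʳ (ι-C> n<j)) (zeroˡ _)

  coefficient-suc : ∀ j n γ → coefficient (suc j) (suc n) γ ≈ ι (suc n) * γ * coefficient j n (γ + 1#)
  coefficient-suc j n γ = begin
    Cn * (ι (suc j !) * rising γ (suc j) * weight (γ + ι (suc j)) (n ∸ j))
      ≈⟨ *-congˡ (*-cong (*-cong (ι-* (suc j) (j !)) (rising-suc γ j)) (weight-cong (n ∸ j) shift)) ⟩
    Cn * ((1# + ι j) * F * (γ * G) * W)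
      ≈⟨ solve 6 (λ Cn J F g G W → Cn :* ((con 1 :+ J) :* F :* (g :* G) :* W)
                                  := (con 1 :+ J) :* Cn :* (g :* (F :* G :* W)))
               refl Cn (ι j) F γ G W ⟩
    (1# + ι j) * Cn * (γ * (F * G * W))
      ≈⟨ *-congʳ absorb ⟩
    ι (suc n) * ι (n C j) * (γ * (F * G * W))
      ≈⟨ solve 5 (λ N Cnj g F GW → N :* Cnj :* (g :* (F :* GW)) := N :* g :* (Cnj :* (F :* GW))) refl _ _ _ _ _ ⟩
    ι (suc n) * γ * coefficient j n (γ + 1#) ∎
    where
    Cn = ι (suc n C suc j)
    F = ι (j !)
    G = rising (γ + 1#) j
    W = weight (γ + 1# + ι j) (n ∸ j)
    shift : γ + ι (suc j) ≈ γ + 1# + ι j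
    shift = sym (+-assoc γ 1# (ι j))
    absorb : (1# + ι j) * Cn ≈ ι (suc n) * ι (n C j)
    absorb = begin
      ι (suc j) * Cn                 ≈⟨ ι-* (suc j) (suc n C suc j) ⟨
      ι (suc j *ℕ (suc n C suc j))   ≡⟨ ≡.cong ι (C-absorb n j) ⟩
      ι (suc n *ℕ (n C j))           ≈⟨ ι-* (suc n) (n C j) ⟩
      ι (suc n) * ι (n C j)          ∎

  closed-form : ℕ → ℕ → Carrier → Carrier
  closed-form p n γ = Σ≤ p (λ j → ι (p C j) * coefficient j n γ)

  closed-form-suc : ∀ p n γ →
    closed-form (suc p) (suc n) γ ≈ closed-form p (suc n) γ + ι (suc n) * γ * closed-form p n (γ + 1#)
  closed-form-suc p n γ = trans (Σ≤-pascal p (λ j → coefficient j (suc n) γ)) (+-congˡ (begin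
    Σ≤ p (λ j → ι (p C j) * coefficient (suc j) (suc n) γ)
      ≈⟨ Σ≤-cong′ p (λ j → *-congˡ (coefficient-suc j n γ)) ⟩
    Σ≤ p (λ j → ι (p C j) * (ι (suc n) * γ * coefficient j n (γ + 1#)))
      ≈⟨ Σ≤-cong′ p (λ j → x∙yz≈y∙xz (ι (p C j)) _ _) ⟩
    Σ≤ p (λ j → ι (suc n) * γ * (ι (p C j) * coefficient j n (γ + 1#)))
      ≈⟨ Σ≤-*ˡ p (ι (suc n) * γ) _ ⟩
    ι (suc n) * γ * closed-form p n (γ + 1#) ∎))

  closed-form-zeroʳ : ∀ p γ → closed-form p 0 γ ≈ 1#
  closed-form-zeroʳ zero    γ =
    solve 0 ((con 1 :+ con 0) :* ((con 1 :+ con 0) :* ((con 1 :+ con 0) :* con 1 :* (con 1 :* con 1))) := con 1) refl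
  closed-form-zeroʳ (suc p) γ = begin
    closed-form (suc p) 0 γ                                        ≈⟨ Σ≤-uncons p _ ⟩
    _ + Σ≤ p (λ j → ι (suc p C suc j) * coefficient (suc j) 0 γ)
      ≈⟨ +-cong (closed-form-zeroʳ 0 γ) (Σ≤-zero p vanish) ⟩
    1# + 0#                                                        ≈⟨ +-identityʳ 1# ⟩
    1#                                                             ∎
    where
    vanish : ∀ j → ι (suc p C suc j) * coefficient (suc j) 0 γ ≈ 0#
    vanish j = trans (*-congˡ (coefficient-C> {suc j} γ (s≤s z≤n))) (zeroʳ _)

  series≈closed-form : ∀ p n γ → series γ (α + β + γ + ι p) n ≈ closed-form p n γ
  series≈closed-form zero n γ = begin
    series γ (α + β + γ + 0#) n                           ≈⟨ series-cong n refl (+-identityʳ _) ⟩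
    series γ (α + β + γ) n                                ≈⟨ saalschütz γ n ⟩
    weight γ n                                            ≈⟨ weight-cong n (+-identityʳ γ) ⟨
    weight (γ + 0#) n
      ≈⟨ solve 1 (λ W → W := (con 1 :+ con 0) :* ((con 1 :+ con 0) :* ((con 1 :+ con 0) :* con 1 :* W))) refl _ ⟩
    closed-form 0 n γ                                     ∎
  series≈closed-form (suc p) zero γ =
    trans (solve 0 ((con 1 :+ con 0) :* (con 1 :* con 1) :* (con 1 :* con 1) := con 1) refl)
          (sym (closed-form-zeroʳ (suc p) γ))
  series≈closed-form (suc p) (suc n) γ = begin
    series γ (δ + ι (suc p)) (suc n)
      ≈⟨ series-cong (suc n) refl (solve 2 (λ d P → d :+ (con 1 :+ P) := d :+ P :+ con 1) refl δ (ι p)) ⟩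
    series γ (δ + ι p + 1#) (suc n)
      ≈⟨ series-contiguity γ (δ + ι p) n ⟩
    series γ (δ + ι p) (suc n) + ι (suc n) * γ * series (γ + 1#) (δ + ι p + 1#) n
      ≈⟨ +-cong (series≈closed-form p (suc n) γ)
                (*-congˡ (trans (series-cong n refl shift) (series≈closed-form p n (γ + 1#)))) ⟩
    closed-form p (suc n) γ + ι (suc n) * γ * closed-form p n (γ + 1#)
      ≈⟨ closed-form-suc p n γ ⟨
    closed-form (suc p) (suc n) γ ∎
    where
    δ = α + β + γ
    shift : δ + ι p + 1# ≈ α + β + (γ + 1#) + ι p
    shift = solve 4 (λ a b g P → a :+ b :+ g :+ P :+ con 1 := a :+ b :+ (g :+ con 1) :+ P) refl α β γ (ι p)

  closed-form-symmetric : ∀ γ p n → closed-form p n γ * weight γ p ≈ closed-form n p γ * weight γ n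
  closed-form-symmetric γ p n = begin
    closed-form p n γ * weight γ p      ≈⟨ Σ≤-*ʳ p (weight γ p) _ ⟨
    Σ≤ p (t p n)                        ≈⟨ Σ≤-extend p n (t p n) (λ j p<j → t-vanish p<j) ⟨
    Σ≤ (p +ℕ n) (t p n)                 ≈⟨ Σ≤-cong′ (p +ℕ n) (t-sym p n) ⟩
    Σ≤ (p +ℕ n) (t n p)                 ≡⟨ ≡.cong (λ q → Σ≤ q (t n p)) (ℕ.+-comm p n) ⟩
    Σ≤ (n +ℕ p) (t n p)                 ≈⟨ Σ≤-extend n p (t n p) (λ j n<j → t-vanish n<j) ⟩
    Σ≤ n (t n p)                        ≈⟨ Σ≤-*ʳ n (weight γ n) _ ⟩
    closed-form n p γ * weight γ n      ∎
    where
    t : ℕ → ℕ → ℕ → Carrier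
    t p n j = ι (p C j) * coefficient j n γ * weight γ p

    t-vanish : ∀ {p n j} → p < j → t p n j ≈ 0#
    t-vanish p<j = trans (*-congʳ (trans (*-congʳ (ι-C> p<j)) (zeroˡ _))) (zeroˡ _)

    t-vanish′ : ∀ {p n j} → p < j → t n p j ≈ 0#
    t-vanish′ {p} p<j = trans (*-congʳ (trans (*-congˡ (coefficient-C> γ p<j)) (zeroʳ _))) (zeroˡ _)

    t-sym : ∀ p n j → t p n j ≈ t n p j
    t-sym p n j with ℕ.≤-<-connex j p | ℕ.≤-<-connex j n
    ... | inj₂ p<j | _         = trans (t-vanish p<j) (sym (t-vanish′ p<j))
    ... | inj₁ _   | inj₂ n<j  = trans (t-vanish′ n<j) (sym (t-vanish n<j))
    ... | inj₁ j≤p | inj₁ j≤n = begin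
      Cp * (Cn * (F * G * Wn)) * weight γ p   ≈⟨ *-congˡ (weight-∸ γ j≤p) ⟩
      Cp * (Cn * (F * G * Wn)) * (Wj * Wp)    ≈⟨ solve 7 (λ P Q F G Wn Wp Wj → P :* (Q :* (F :* G :* Wn)) :* (Wj :* Wp)
                                                                        := Q :* (P :* (F :* G :* Wp)) :* (Wj :* Wn))
                                                      refl Cp Cn F G Wn Wp Wj ⟩
      Cn * (Cp * (F * G * Wp)) * (Wj * Wn)    ≈⟨ *-congˡ (weight-∸ γ j≤n) ⟨
      Cn * (Cp * (F * G * Wp)) * weight γ n   ∎
      where
      Cp = ι (p C j)
      Cn = ι (n C j)
      F = ι (j !)
      G = rising γ j
      Wj = weight γ j
      Wn = weight (γ + ι j) (n ∸ j)
      Wp = weight (γ + ι j) (p ∸ j)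

module Specialisation {c ℓ : Level} (R : CommutativeRing c ℓ) (r : CommutativeRing.Carrier R) (m : ℕ) where
  open import Data.Nat using (suc) renaming (_+_ to _+ℕ_)
  import Data.Nat.Properties as ℕ
  import Relation.Binary.PropositionalEquality as ≡
  open CommutativeRing R
  open import Relation.Binary.Reasoning.Setoid setoid
  open Poly R
  open RingSolver R
  open Pochhammer R
  open Binomial
  open Hypergeometric R r (ι (suc m) - r) public

  private
    β : Carrier
    β = ι (suc m) - r

    β+r≈1+m : β + r ≈ 1# + ι m
    β+r≈1+m = trans (+-assoc _ (- r) r) (trans (+-congˡ (-‿inverseˡ r)) (+-identityʳ _))

  ∏-head≈rising : ∀ k → ∏[ 0 , k ] (λ i → (ι (m +ℕ i +ℕ 1) - r) * (ι i + r)) ≈ rising r k * rising β k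
  ∏-head≈rising k = trans (∏-cong 0 k factor) (∏-distrib 0 k (λ i → r + ι i) (λ i → β + ι i))
    where
    factor : ∀ i → (ι (m +ℕ i +ℕ 1) - r) * (ι i + r) ≈ (r + ι i) * (β + ι i)
    factor i = trans (*-congʳ (+-congʳ (trans (ι-+ (m +ℕ i) 1) (+-congʳ (ι-+ m i)))))
      (solve 4 (λ M I r -r → (M :+ I :+ (con 1 :+ con 0) :+ -r) :* (I :+ r)
                          := (r :+ I) :* ((con 1 :+ M) :+ -r :+ I))
        refl (ι m) (ι i) r (- r))

  module _ {u d : ℕ} (m≤u : m ≤ u) (m≤d : m ≤ d) where
    private
      n = d ∸ m
      p = u ∸ m
      D = r + β + r + ι p

    ∏-tail≈rising : ∀ {k} → k ≤ n →
      ∏[ suc k , n ∸ k ] (λ j → (ι (n ∸ j) + r) * (ι (u +ℕ j) + r))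
        ≈ rising r (n ∸ k) * rising (D + ι k) (n ∸ k)
    ∏-tail≈rising {k} k≤n =
      trans (∏-distrib (suc k) l (λ j → ι (n ∸ j) + r) (λ j → ι (u +ℕ j) + r)) (*-cong reversed shifted)
      where
      l = n ∸ k
      reversed : ∏[ suc k , l ] (λ j → ι (n ∸ j) + r) ≈ rising r l
      reversed = begin
        ∏[ suc k , l ] (λ j → ι (n ∸ j) + r)
          ≡⟨ ≡.cong (λ q → ∏[ suc k , l ] (λ j → ι (q ∸ j) + r)) (≡.sym (ℕ.m+[n∸m]≡n k≤n)) ⟩
        ∏[ suc k , l ] (λ j → ι ((k +ℕ l) ∸ j) + r)   ≈⟨ ∏-reverse k l (λ t → ι t + r) ⟩
        ∏[ 0 , l ] (λ i → ι i + r)                    ≈⟨ ∏-cong 0 l (λ i → +-comm (ι i) r) ⟩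
        rising r l                                    ∎
      factor : ∀ i → ι (u +ℕ (suc k +ℕ i)) + r ≈ D + ι k + ι i
      factor i = begin
        ι (u +ℕ (suc k +ℕ i)) + r
          ≡⟨ ≡.cong (λ q → ι (q +ℕ (suc k +ℕ i)) + r) (≡.sym (ℕ.m+[n∸m]≡n m≤u)) ⟩
        ι ((m +ℕ p) +ℕ (suc k +ℕ i)) + r
          ≈⟨ +-congʳ (trans (ι-+ (m +ℕ p) (suc k +ℕ i)) (+-cong (ι-+ m p) (+-congˡ (ι-+ k i)))) ⟩
        (ι m + ι p) + (1# + (ι k + ι i)) + r
          ≈⟨ solve 5 (λ M P K I r → (M :+ P) :+ (con 1 :+ (K :+ I)) :+ r := (con 1 :+ M) :+ r :+ P :+ K :+ I)
                     refl (ι m) (ι p) (ι k) (ι i) r ⟩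
        (1# + ι m) + r + ι p + ι k + ι i
          ≈⟨ +-congʳ (+-congʳ (+-congʳ (+-congʳ (trans (+-comm r β) β+r≈1+m)))) ⟨
        D + ι k + ι i                           ∎
      shifted : ∏[ suc k , l ] (λ j → ι (u +ℕ j) + r) ≈ rising (D + ι k) l
      shifted = trans (reflexive (∏-shift (suc k) l (λ j → ι (u +ℕ j) + r))) (∏-cong 0 l factor)

    P≈closed-form : P r u d m ≈ closed-form p n r
    P≈closed-form = begin
      P r u d m
        ≈⟨ Σ≤-cong n (λ k k≤n → *-cong (*-cong (reflexive (≡.cong ι (C≡binom∸ k≤n))) (∏-head≈rising k))
                                       (∏-tail≈rising k≤n)) ⟩
      Σ≤ n (λ k → term r D k (n ∸ k))   ≈⟨ Σ≤≈conv n (term r D) ⟩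
      series r D n                      ≈⟨ series≈closed-form p n r ⟩
      closed-form p n r                 ∎

  ψ≈weight : ∀ q → ψ r q (ι m) ≈ weight r q
  ψ≈weight q = trans (reflexive (∏-shift 1 q _))
                     (trans (∏-cong 0 q factor) (∏-distrib 0 q (λ i → (r + r) + ι i) (λ i → (β + r) + ι i)))
    where
    factor : ∀ i → (ι m + ι (suc i)) * (ι i + (r + r)) ≈ ((r + r) + ι i) * ((β + r) + ι i)
    factor i = trans (solve 3 (λ M I r → (M :+ (con 1 :+ I)) :* (I :+ (r :+ r)) := ((r :+ r) :+ I) :* ((con 1 :+ M) :+ I))
                              refl (ι m) (ι i) r)
                     (*-congˡ (+-congʳ (sym β+r≈1+m)))

theorem5p7 : ∀ {c ℓ : Level} (R : CommutativeRing c ℓ) (r : CommutativeRing.Carrier R)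
    (u d m : ℕ) → 1 ≤ m → m ≤ u → m ≤ d →
    CommutativeRing._≈_ R
      (CommutativeRing._*_ R (Poly.P R r u d m) (Poly.ψ R r (u ∸ m) (Poly.ι R m)))
      (CommutativeRing._*_ R (Poly.P R r d u m) (Poly.ψ R r (d ∸ m) (Poly.ι R m)))
theorem5p7 R r u d m _ m≤u m≤d = begin
  P r u d m * ψ r (u ∸ m) (ι m)                       ≈⟨ *-cong (P≈closed-form m≤u m≤d) (ψ≈weight (u ∸ m)) ⟩
  closed-form (u ∸ m) (d ∸ m) r * weight r (u ∸ m)    ≈⟨ closed-form-symmetric r (u ∸ m) (d ∸ m) ⟩
  closed-form (d ∸ m) (u ∸ m) r * weight r (d ∸ m)    ≈⟨ *-cong (P≈closed-form m≤d m≤u) (ψ≈weight (d ∸ m)) ⟨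
  P r d u m * ψ r (d ∸ m) (ι m)                       ∎
  where
  open CommutativeRing R
  open Poly R
  open Specialisation R r m
  open import Relation.Binary.Reasoning.Setoid setoid
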